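{- Let $\Sigma$ be a finite alphabet, let $x\in\Sigma^*$ be a word of length $m>0$, and let $\tilde{x}$ be the circular word whose linearizations are the rotations of $x$. Let $\mathcal{F}_{\tilde{x}}$ be the set of factors of $xx$ of length at most $m$, and let $$\mathcal{M}_{\mathcal{F}_{\tilde{x}}}=\{aub \mid a,b\in\Sigma,\ u\in\Sigma^*,\ aub\notin\mathcal{F}_{\tilde{x}},\ au\in\mathcal{F}_{\tilde{x}},\ ub\in\mathcal{F}_{\tilde{x}}\}.$$ Then $\mathcal{M}_{\mathcal{F}_{\tilde{x}}}$ contains precisely $\ell$ words of length $m+1$, where $\ell$ is the number of distinct rotations of $x$, i.e. $\ell=|\{x^{\langle i\rangle}\mid i=0,\ldots,m-1\}|$.
   Context: For a word $x=x[0]x[1]\cdots x[m-1]$ and $0\le i<m$, the $i$-th rotation is $x^{\langle i\rangle}=x[i\,..\,m-1]\,x[0\,..\,i-1]$. Two words are equivalent if one is a rotation of the other; a circular word $\tilde{x}$ is an equivalence class, and any member of it is a linearization. The set $\mathcal{F}_{\tilde{x}}$ (factors of $xx$ of length at most $|x|$) does not depend on the chosen linearization $x$. -}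

module Defs where

open import Data.Nat using (ℕ; _≤_; _<_)
open import Data.Fin using (Fin)
open import Data.List using (List; []; _∷_; _++_; [_]; length; take; drop)
open import Data.List.Membership.Propositional using (_∈_)
open import Data.List.Relation.Unary.Unique.Propositional using (Unique)
open import Data.Product using (Σ; ∃; _×_)
open import Relation.Binary.PropositionalEquality using (_≡_)
open import Relation.Nullary using (¬_)
open import Function.Bundles using (_⇔_)

-- A finite alphabet Σ is represented (up to renaming) by Fin k.
Word : ℕ → Set
Word k = List (Fin k)

rotation : ∀ {k} → Word k → ℕ → Word k
rotation x i = drop i x ++ take i x

Factor : ∀ {k} → Word k → Word k → Set
Factor u w = ∃ λ p → ∃ λ s → p ++ u ++ s ≡ w

InF : ∀ {k} → Word k → Word k → Set
InF x w = Factor w (x ++ x) × length w ≤ length x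

InM : ∀ {k} → Word k → Word k → Set
InM {k} x w = ∃ λ (a : Fin k) → ∃ λ (u : Word k) → ∃ λ (b : Fin k) →
  (w ≡ a ∷ (u ++ [ b ])) × ¬ InF x (a ∷ (u ++ [ b ])) × InF x (a ∷ u) × InF x (u ++ [ b ])

IsRotation : ∀ {k} → Word k → Word k → Set
IsRotation x w = ∃ λ i → i < length x × w ≡ rotation x i

HasSize : ∀ {k} → (Word k → Set) → ℕ → Set
HasSize {k} P n = Σ (List (Word k)) λ l → Unique l × (∀ w → (w ∈ l) ⇔ P w) × length l ≡ n

module Submission where

-- Two words are conjugate when x = p ++ r and v = r ++ p; for a nonempty x
-- the conjugates of x are exactly its rotations x⟨i⟩, 0 ≤ i < |x|.  The proof
-- rests on three facts about conjugates, proved first for lists over any type: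
--   * a factor of xx of length |x| is a conjugate of x (by Levi's lemma);
--   * if a ∷ u is a conjugate of x, so is u ++ [a] (rotation by one letter);
--   * conjugates are permutations of x, so if a ∷ u and u ++ [b] are both
--     conjugates of x then a ∷ u ↭ b ∷ u and hence a ≡ b.
-- Consequently a word of length m + 1 is a minimal absent word of x̃ iff it has
-- the form  wrap (a ∷ u) = a ∷ u ++ [a]  with a ∷ u a rotation of x: both
-- a ∷ u and u ++ [a] are factors of xx of length m, while the whole word is too
-- long to be one.  Since wrap is injective, the minimal absent words of length
-- m + 1 are the injective image of the (deduplicated) list of rotations, so
-- both sets have as many elements as x has distinct rotations.

open import Defs
open import Data.Nat using (ℕ; suc; _+_; _≤_; _<_; s≤s; z≤n)
open import Data.Nat.Properties
  using (+-cancelʳ-≤; +-monoʳ-≤; m≤m+n; m<m+n; ≤-reflexive; <⇒≢; <⇒≱; suc-injective; module ≤-Reasoning)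
import Data.Fin.Properties as Fin
open import Data.List using (List; []; _∷_; _++_; [_]; length; take; drop; map; upTo; deduplicate)
open import Data.List.Properties
  using (length-++; ++-assoc; ++-identityʳ; ∷-injective; ∷ʳ-injectiveˡ; take++drop≡id; length-map; ≡-dec)
open import Data.List.Membership.Propositional using (_∈_)
open import Data.List.Membership.Propositional.Properties
  using (∈-map⁺; ∈-map⁻; ∈-upTo⁺; ∈-upTo⁻; ∈-deduplicate⁺; ∈-deduplicate⁻)
import Data.List.Relation.Unary.Unique.Propositional.Properties as Unique
open import Data.List.Relation.Unary.Unique.DecPropositional.Properties using (deduplicate-!)
open import Data.List.Relation.Binary.Permutation.Propositional using (_↭_; ↭-sym; ↭-trans)
open import Data.List.Relation.Binary.Permutation.Propositional.Properties
  using (↭-length; ++-comm; drop-mid; ↭-singleton-inv)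
open import Data.Empty using (⊥-elim)
open import Data.Product using (Σ; ∃; _×_; _,_)
open import Relation.Binary.PropositionalEquality
  using (_≡_; refl; sym; trans; cong; cong₂; subst; module ≡-Reasoning)
open import Relation.Nullary using (¬_; Dec)
open import Function.Bundles using (_⇔_; mk⇔; Equivalence)

module _ {A : Set} where

  Conjugate : List A → List A → Set
  Conjugate x v = ∃ λ p → ∃ λ r → x ≡ p ++ r × v ≡ r ++ p

  conjugate-↭ : ∀ {x v} → Conjugate x v → v ↭ x
  conjugate-↭ (p , r , refl , refl) = ++-comm r p

  conjugate-length : ∀ {x v} → Conjugate x v → length v ≡ length x
  conjugate-length c = ↭-length (conjugate-↭ c)

  conjugate-step : ∀ {x a u} → Conjugate x (a ∷ u) → Conjugate x (u ++ [ a ])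
  conjugate-step {a = a} {u} (p , [] , refl , refl) =
    [ a ] , u , ++-identityʳ (a ∷ u) , refl
  conjugate-step (p , c ∷ q , refl , refl) =
    p ++ [ c ] , q , sym (++-assoc p [ c ] q) , ++-assoc q p [ c ]

  levi : ∀ (p q x y : List A) → p ++ q ≡ x ++ y → length p ≤ length x →
         ∃ λ r → x ≡ p ++ r × q ≡ r ++ y
  levi []      q x       y e _         = x , refl , e
  levi (a ∷ p) q (b ∷ x) y e (s≤s le) with refl , e′ ← ∷-injective e
    with r , e₁ , e₂ ← levi p q x y e′ le = r , cong (a ∷_) e₁ , e₂

  equal-length-prefix : ∀ (p t r s : List A) → p ++ r ≡ t ++ s → length p ≡ length t → p ≡ t
  equal-length-prefix []      []      r s e l = refl
  equal-length-prefix (a ∷ p) (b ∷ t) r s e l with refl , e′ ← ∷-injective e =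
    cong (a ∷_) (equal-length-prefix p t r s e′ (suc-injective l))

  square-prefix-short : ∀ (x p v s : List A) → p ++ v ++ s ≡ x ++ x →
                        length v ≡ length x → length p ≤ length x
  square-prefix-short x p v s e lv = +-cancelʳ-≤ (length x) (length p) (length x) (begin
    length p + length x              ≡⟨ cong (length p +_) (sym lv) ⟩
    length p + length v              ≤⟨ +-monoʳ-≤ (length p) (m≤m+n (length v) (length s)) ⟩
    length p + (length v + length s) ≡⟨ cong (length p +_) (sym (length-++ v)) ⟩
    length p + length (v ++ s)       ≡⟨ sym (length-++ p) ⟩
    length (p ++ v ++ s)             ≡⟨ cong length e ⟩
    length (x ++ x)                  ≡⟨ length-++ x ⟩
    length x + length x              ∎)
    where open ≤-Reasoning

  -- A factor of xx of length |x| is a conjugate of x: writing x = p ++ r, the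
  -- factor v is a prefix of r ++ x = (r ++ p) ++ r of the same length as r ++ p.
  square-factor-conjugate : ∀ (x p v s : List A) → p ++ v ++ s ≡ x ++ x →
                            length v ≡ length x → Conjugate x v
  square-factor-conjugate x p v s e lv
    with r , x≡pr , vs≡rx ← levi p (v ++ s) x x e (square-prefix-short x p v s e lv) =
    p , r , x≡pr , equal-length-prefix v (r ++ p) s r vs≡rpr |v|≡|rp|
    where
    vs≡rpr : v ++ s ≡ (r ++ p) ++ r
    vs≡rpr = trans vs≡rx (trans (cong (r ++_) x≡pr) (sym (++-assoc r p r)))
    |v|≡|rp| : length v ≡ length (r ++ p)
    |v|≡|rp| = trans lv (sym (conjugate-length (p , r , x≡pr , refl)))

  drop-prefix : ∀ (p r : List A) → drop (length p) (p ++ r) ≡ r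
  drop-prefix []      r = refl
  drop-prefix (a ∷ p) r = drop-prefix p r

  take-prefix : ∀ (p r : List A) → take (length p) (p ++ r) ≡ p
  take-prefix []      r = refl
  take-prefix (a ∷ p) r = cong (a ∷_) (take-prefix p r)

  ∷-cancel-↭ : ∀ (a b : A) u → a ∷ u ↭ b ∷ u → a ≡ b
  ∷-cancel-↭ a b []      π with refl ← ↭-singleton-inv π = refl
  ∷-cancel-↭ a b (c ∷ u) π = ∷-cancel-↭ a b u (drop-mid [ a ] [ b ] π)

  wrap : List A → List A
  wrap []      = []
  wrap (a ∷ u) = a ∷ u ++ [ a ]

  wrap-injective : ∀ {v v′} → wrap v ≡ wrap v′ → v ≡ v′
  wrap-injective {[]}    {[]}     e = refl
  wrap-injective {a ∷ u} {b ∷ u′} e with refl , e′ ← ∷-injective e =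
    cong (a ∷_) (∷ʳ-injectiveˡ u u′ e′)

module _ {k : ℕ} where

  conjugate-factor : ∀ {x v : Word k} → Conjugate x v → Factor v (x ++ x)
  conjugate-factor (p , r , refl , refl) = p , r , (begin
    p ++ (r ++ p) ++ r ≡⟨ cong (p ++_) (++-assoc r p r) ⟩
    p ++ r ++ p ++ r   ≡⟨ sym (++-assoc p r (p ++ r)) ⟩
    (p ++ r) ++ p ++ r ∎)
    where open ≡-Reasoning

  conjugate-InF : ∀ {x v : Word k} → Conjugate x v → InF x v
  conjugate-InF c = conjugate-factor c , ≤-reflexive (conjugate-length c)

  long-not-InF : ∀ {x w : Word k} → length x < length w → ¬ InF x w
  long-not-InF lt (_ , le) = <⇒≱ lt le

  full-InF-conjugate : ∀ {x v : Word k} → InF x v → length v ≡ length x → Conjugate x v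
  full-InF-conjugate {x} {v} ((p , s , e) , _) lv = square-factor-conjugate x p v s e lv

  rotation-conjugate : ∀ {x v : Word k} → IsRotation x v → Conjugate x v
  rotation-conjugate {x} (i , _ , refl) = take i x , drop i x , sym (take++drop≡id i x) , refl

  conjugate-rotation : ∀ {x v : Word k} → 0 < length x → Conjugate x v → IsRotation x v
  conjugate-rotation pos (p , [] , refl , refl) =
    0 , pos , sym (trans (++-identityʳ (p ++ [])) (++-identityʳ p))
  conjugate-rotation _ (p , c ∷ q , refl , refl) =
    length p , |p|<|pcq| ,
    sym (cong₂ _++_ (drop-prefix p (c ∷ q)) (take-prefix p (c ∷ q)))
    where
    |p|<|pcq| : length p < length (p ++ c ∷ q)
    |p|<|pcq| = subst (length p <_) (sym (length-++ p)) (m<m+n (length p) (s≤s z≤n))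

  wrap-minimalAbsent : ∀ {x u : Word k} {a} → Conjugate x (a ∷ u) →
                       InM x (wrap (a ∷ u)) × length (wrap (a ∷ u)) ≡ suc (length x)
  wrap-minimalAbsent {x} {u} {a} c =
    (a , u , a , refl , too-long , conjugate-InF c , conjugate-InF c′) , |w|≡
    where
    c′ : Conjugate x (u ++ [ a ])
    c′ = conjugate-step c
    |w|≡ : length (wrap (a ∷ u)) ≡ suc (length x)
    |w|≡ = cong suc (conjugate-length c′)
    too-long : ¬ InF x (wrap (a ∷ u))
    too-long = long-not-InF {x = x} (≤-reflexive (sym |w|≡))

  minimalAbsent-wrap : ∀ {x w : Word k} → InM x w → length w ≡ suc (length x) →
                       ∃ λ v → Conjugate x v × w ≡ wrap v
  minimalAbsent-wrap {x} (a , u , b , refl , _ , au∈F , ub∈F) |w|≡ =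
    a ∷ u , ca , cong (λ c → a ∷ u ++ [ c ]) (sym a≡b)
    where
    |ub|≡ : length (u ++ [ b ]) ≡ length x
    |ub|≡ = suc-injective |w|≡
    cb : Conjugate x (u ++ [ b ])
    cb = full-InF-conjugate ub∈F |ub|≡
    ca : Conjugate x (a ∷ u)
    ca = full-InF-conjugate au∈F (trans (↭-length (++-comm [ b ] u)) |ub|≡)
    a≡b : a ≡ b
    a≡b = ∷-cancel-↭ a b u
      (↭-trans (conjugate-↭ ca) (↭-trans (↭-sym (conjugate-↭ cb)) (++-comm u [ b ])))

  minimalAbsent⇔wrapped-rotation : ∀ {x : Word k} → 0 < length x → ∀ w →
    (InM x w × length w ≡ suc (length x)) ⇔ (∃ λ v → IsRotation x v × w ≡ wrap v)
  minimalAbsent⇔wrapped-rotation {x} pos w = mk⇔ to from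
    where
    to : InM x w × length w ≡ suc (length x) → ∃ λ v → IsRotation x v × w ≡ wrap v
    to (m , |w|≡) with v , c , eq ← minimalAbsent-wrap m |w|≡ = v , conjugate-rotation pos c , eq
    from-conjugate : ∀ v → Conjugate x v → InM x (wrap v) × length (wrap v) ≡ suc (length x)
    from-conjugate []      c = ⊥-elim (<⇒≢ pos (conjugate-length c))
    from-conjugate (a ∷ u) c = wrap-minimalAbsent c
    from : (∃ λ v → IsRotation x v × w ≡ wrap v) → InM x w × length w ≡ suc (length x)
    from (v , rot , refl) = from-conjugate v (rotation-conjugate rot)

  _≟ʷ_ : (u v : Word k) → Dec (u ≡ v)
  _≟ʷ_ = ≡-dec Fin._≟_

  rotations : Word k → List (Word k)
  rotations x = deduplicate _≟ʷ_ (map (rotation x) (upTo (length x)))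

  rotations-hasSize : ∀ (x : Word k) → HasSize (IsRotation x) (length (rotations x))
  rotations-hasSize x = rotations x , deduplicate-! _≟ʷ_ _ , members , refl
    where
    members : ∀ w → (w ∈ rotations x) ⇔ IsRotation x w
    members w = mk⇔ to from
      where
      to : w ∈ rotations x → IsRotation x w
      to w∈ with i , i∈ , eq ← ∈-map⁻ (rotation x) (∈-deduplicate⁻ _≟ʷ_ _ w∈) =
        i , ∈-upTo⁻ i∈ , eq
      from : IsRotation x w → w ∈ rotations x
      from (i , lt , refl) = ∈-deduplicate⁺ _≟ʷ_ (∈-map⁺ (rotation x) (∈-upTo⁺ lt))

  hasSize-image : ∀ {P Q : Word k → Set} {n} (f : Word k → Word k) →
                  (∀ {v v′} → f v ≡ f v′ → v ≡ v′) →
                  (∀ w → Q w ⇔ (∃ λ v → P v × w ≡ f v)) →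
                  HasSize P n → HasSize Q n
  hasSize-image {Q = Q} f f-inj Q⇔ (l , l-unique , l⇔ , refl) =
    map f l , Unique.map⁺ f-inj l-unique , members , length-map f l
    where
    members : ∀ w → (w ∈ map f l) ⇔ Q w
    members w = mk⇔ to from
      where
      to : w ∈ map f l → Q w
      to w∈ with v , v∈ , eq ← ∈-map⁻ f w∈ =
        Equivalence.from (Q⇔ w) (v , Equivalence.to (l⇔ v) v∈ , eq)
      from : Q w → w ∈ map f l
      from q with v , pv , refl ← Equivalence.to (Q⇔ w) q = ∈-map⁺ f (Equivalence.from (l⇔ v) pv)

lemma1 : (k : ℕ) (x : Word k) → 0 < length x →
    Σ ℕ (λ ℓ → HasSize (IsRotation x) ℓ
             × HasSize (λ w → InM x w × length w ≡ suc (length x)) ℓ)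
lemma1 k x pos =
  length (rotations x) ,
  rotations-hasSize x ,
  hasSize-image wrap wrap-injective (minimalAbsent⇔wrapped-rotation pos) (rotations-hasSize x)
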